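{- If $G$ is a hypo-unique domination graph, then $b(G)\leq\delta(G)+1$.
   Context: All graphs are finite, simple and undirected; $\delta(G)$ is the minimum degree. A dominating set of $G$ is a set $D\subseteq V(G)$ such that every vertex not in $D$ has a neighbor in $D$; $\gamma(G)$ is the minimum size of a dominating set, and a dominating set of size $\gamma(G)$ is a $\gamma$-set. The bondage number $b(G)$ of a graph with at least one edge is the minimum number of edges whose removal from $G$ yields a graph with domination number larger than $\gamma(G)$. A graph $G$ is a hypo-unique domination graph if $G$ has at least two distinct $\gamma$-sets, but for every $v\in V(G)$ the graph $G-v$ has exactly one $\gamma$-set. -}

module Defs where

open import Data.Nat using (ℕ; suc; _+_; _≤_; _<_; _∸_; _<ᵇ_)
open import Data.Fin using (Fin; toℕ; punchIn)
open import Data.Fin.Subset using (Subset; _∈_; ∣_∣)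
open import Data.Bool using (Bool; true; false; if_then_else_; _∧_)
open import Data.List using (List; map; allFin)
open import Data.Nat.ListAction using (sum)
open import Data.Vec using (tabulate)
open import Data.Product using (Σ; ∃; _×_)
open import Data.Sum using (_⊎_)
open import Relation.Binary.PropositionalEquality using (_≡_; _≢_)

record Graph (n : ℕ) : Set where
  field
    adj   : Fin n → Fin n → Bool
    sym   : ∀ i j → adj i j ≡ adj j i
    irrefl : ∀ i → adj i i ≡ false
open Graph public

Adj : ∀ {n} → Graph n → Fin n → Fin n → Set
Adj G u v = adj G u v ≡ true

edgeCount : ∀ {n} → Graph n → ℕ
edgeCount {n} G =
  sum (map (λ i → sum (map (λ j → if (toℕ i <ᵇ toℕ j) ∧ adj G i j then 1 else 0)
                           (allFin n)))
           (allFin n))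

neighbourhood : ∀ {n} → Graph n → Fin n → Subset n
neighbourhood G v = tabulate (adj G v)

degree : ∀ {n} → Graph n → Fin n → ℕ
degree G v = ∣ neighbourhood G v ∣

IsMinDegree : ∀ {n} → Graph n → ℕ → Set
IsMinDegree G d = (∃ λ v → degree G v ≡ d) × (∀ v → d ≤ degree G v)

IsDominating : ∀ {n} → Graph n → Subset n → Set
IsDominating G D = ∀ v → v ∈ D ⊎ (∃ λ u → u ∈ D × Adj G u v)

IsGammaSet : ∀ {n} → Graph n → Subset n → Set
IsGammaSet G D = IsDominating G D × (∀ D' → IsDominating G D' → ∣ D ∣ ≤ ∣ D' ∣)

IsDominationNumber : ∀ {n} → Graph n → ℕ → Set
IsDominationNumber G k = ∃ λ D → IsGammaSet G D × ∣ D ∣ ≡ k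

deleteVertex : ∀ {m} → Graph (suc m) → Fin (suc m) → Graph m
deleteVertex G v = record
  { adj = λ i j → adj G (punchIn v i) (punchIn v j)
  ; sym = λ i j → sym G (punchIn v i) (punchIn v j)
  ; irrefl = λ i → irrefl G (punchIn v i) }

IsSpanningSubgraph : ∀ {n} → Graph n → Graph n → Set
IsSpanningSubgraph H G = ∀ u v → Adj H u v → Adj G u v

HasUniqueGammaSet : ∀ {n} → Graph n → Set
HasUniqueGammaSet G = ∃ λ D → IsGammaSet G D × (∀ D' → IsGammaSet G D' → D' ≡ D)

HasTwoGammaSets : ∀ {n} → Graph n → Set
HasTwoGammaSets G = ∃ λ D₁ → ∃ λ D₂ → IsGammaSet G D₁ × IsGammaSet G D₂ × D₁ ≢ D₂

IsHypoUniqueDomination : ∀ {m} → Graph (suc m) → Set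
IsHypoUniqueDomination G =
  HasTwoGammaSets G × (∀ v → HasUniqueGammaSet (deleteVertex G v))

-- b(G) ≤ k : some set of at most k edges of G whose removal increases γ.
-- (Removal of an edge set F ⊆ E(G) is the spanning subgraph H with E(H) = E(G) ∖ F,
--  so |F| = edgeCount G ∸ edgeCount H.)
BondageAtMost : ∀ {n} → Graph n → ℕ → Set
BondageAtMost G k =
  ∃ λ H → IsSpanningSubgraph H G × (edgeCount G ∸ edgeCount H ≤ k)
        × (∀ γG γH → IsDominationNumber G γG → IsDominationNumber H γH → γG < γH)

-- Let v have minimum degree δ and let D be the unique γ-set of G − v. Deleting the δ edges at v
-- isolates v, so every dominating set of the resulting graph H is {v} plus a dominating set of
-- H − v, whereas γ(G) ≤ 1 + γ(G − v). If D is all of V(G − v), then γ(H) ≥ n while the two distinct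
-- γ-sets of G force γ(G) < n. Otherwise pick y ∉ D and a neighbour u ∈ D of y: if u had no external
-- private neighbour, (D − u) ∪ {y} would be a second γ-set of G − v, so u has one, w. Deleting the
-- edge uw as well leaves D non-dominating in H − v, so by uniqueness γ(H − v) > |D| and γ(H) > γ(G).

module Submission where

open import Defs hiding (sym)
open import Data.Nat using (ℕ; zero; suc; _+_; _≤_; _<_; _<ᵇ_; z≤n; s≤s; _≤?_)
open import Data.Nat.Properties
  using (+-0-commutativeMonoid; +-identityʳ; +-comm; +-assoc; +-mono-≤; +-monoˡ-≤; +-monoʳ-≤;
         ≤-refl; ≤-reflexive; ≤-trans; ≤-<-trans; ≤∧≢⇒<; ≰⇒>; m≤m+n; m≤n+o⇒m∸n≤o; module ≤-Reasoning)
open import Algebra.Properties.CommutativeMonoid.Sum +-0-commutativeMonoid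
  using (sum; sum-syntax; sum-remove; sum-cong-≗; sum-replicate-zero; ∑-distrib-+; ∑-comm)
open import Data.Bool using (Bool; true; false; if_then_else_; _∧_; _∨_; not)
open import Data.Bool.Properties using (∧-assoc; ∧-comm; ∧-identityʳ; ∧-zeroʳ; ∨-comm; ∨-zeroʳ)
  renaming (_≟_ to _≟ᵇ_)
open import Data.Empty using (⊥-elim)
open import Data.Fin using (Fin; zero; suc; toℕ; punchIn; punchOut; _≟_)
open import Data.Fin.Properties using (punchInᵢ≢i; punchIn-punchOut; any?; all?; ¬∀⟶∃¬)
open import Data.Fin.Subset using (Subset; _∈_; _∉_; ∣_∣; ⊤; ⁅_⁆; _∪_; _-_)
open import Data.Fin.Subset.Properties
  using (_∈?_; ∣p∣≤n; ∣p∣≤∣x∷p∣; ∣⊤∣≡n; ∣p∣≡n⇒p≡⊤; p⊆q⇒∣p∣≤∣q∣; x∈⁅x⁆; x∈p∪q⁺;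
         x∈p∧x≢y⇒x∈p-y; x∈p⇒∣p-x∣<∣p∣; ∪-identityʳ)
open import Data.List using (allFin; map)
import Data.List as List
open import Data.List.Properties using (map-tabulate)
open import Data.Nat.ListAction using () renaming (sum to sumᴸ)
open import Data.Vec using (Vec; _∷_; lookup; tabulate; insertAt; removeAt)
open import Data.Vec.Properties
  using (insertAt-lookup; insertAt-punchIn; insertAt-removeAt; []=⇒lookup; lookup⇒[]=; ≡-dec)
open import Data.Product using (∃; ∃₂; _×_; _,_; proj₁; proj₂)
open import Data.Sum using (_⊎_; inj₁; inj₂)
open import Function using (_∘_; case_of_)
open import Relation.Nullary using (¬_; Dec; yes; no; does)
open import Relation.Nullary.Decidable using (_×-dec_; ¬?; dec-true; dec-false)
open import Relation.Binary.PropositionalEquality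

𝟙 : Bool → ℕ
𝟙 b = if b then 1 else 0

𝟙-split : ∀ b p → 𝟙 b ≡ 𝟙 (b ∧ not p) + 𝟙 (b ∧ p)
𝟙-split false p = refl
𝟙-split true false = refl
𝟙-split true true = refl

𝟙-∨ : ∀ b p q → 𝟙 (b ∧ (p ∨ q)) ≤ 𝟙 (b ∧ p) + 𝟙 (b ∧ q)
𝟙-∨ false p q = z≤n
𝟙-∨ true true q = s≤s z≤n
𝟙-∨ true false q = ≤-refl

𝟙≤1 : ∀ b → 𝟙 b ≤ 1
𝟙≤1 false = z≤n
𝟙≤1 true = ≤-refl

𝟙-∧-disjoint : ∀ x y b → 𝟙 x + 𝟙 y ≤ 1 → 𝟙 (x ∧ b) + 𝟙 (y ∧ b) ≤ 𝟙 b
𝟙-∧-disjoint x     y     false _ rewrite ∧-zeroʳ x | ∧-zeroʳ y = z≤n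
𝟙-∧-disjoint true  true  true  (s≤s ())
𝟙-∧-disjoint true  false true  _ = ≤-refl
𝟙-∧-disjoint false false true  _ = z≤n
𝟙-∧-disjoint false true  true  _ = ≤-refl

<ᵇ-asym : ∀ m n → 𝟙 (m <ᵇ n) + 𝟙 (n <ᵇ m) ≤ 1
<ᵇ-asym zero zero = z≤n
<ᵇ-asym zero (suc n) = ≤-refl
<ᵇ-asym (suc m) zero = ≤-refl
<ᵇ-asym (suc m) (suc n) = <ᵇ-asym m n

∧-true-left : ∀ {x y} → x ∧ y ≡ true → x ≡ true
∧-true-left {true} _ = refl

∑-mono-≤ : ∀ {n} {f g : Fin n → ℕ} → (∀ i → f i ≤ g i) → ∑[ i < n ] f i ≤ ∑[ i < n ] g i
∑-mono-≤ {zero} _ = z≤n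
∑-mono-≤ {suc n} f≤g = +-mono-≤ (f≤g zero) (∑-mono-≤ (f≤g ∘ suc))

∑∑-distrib-+ : ∀ {n} (f g : Fin n → Fin n → ℕ) →
  ∑[ i < n ] ∑[ j < n ] (f i j + g i j) ≡ ∑[ i < n ] ∑[ j < n ] f i j + ∑[ i < n ] ∑[ j < n ] g i j
∑∑-distrib-+ {n} f g =
  trans (sum-cong-≗ (λ i → ∑-distrib-+ (f i) (g i))) (∑-distrib-+ {n} (λ i → ∑[ j < n ] f i j) _)

∑-pick : ∀ {n} (f : Fin n → Bool) (a : Fin n) → ∑[ i < n ] 𝟙 (f i ∧ does (i ≟ a)) ≡ 𝟙 (f a)
∑-pick {suc n} f a = begin
  ∑[ i < suc n ] 𝟙 (f i ∧ does (i ≟ a))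
    ≡⟨ sum-remove {i = a} (λ i → 𝟙 (f i ∧ does (i ≟ a))) ⟩
  𝟙 (f a ∧ does (a ≟ a)) + ∑[ i < n ] 𝟙 (f (punchIn a i) ∧ does (punchIn a i ≟ a))
    ≡⟨ cong₂ _+_ at-a (trans (sum-cong-≗ off-a) (sum-replicate-zero n)) ⟩
  𝟙 (f a) + 0
    ≡⟨ +-identityʳ _ ⟩
  𝟙 (f a) ∎
  where
  open ≡-Reasoning
  at-a : 𝟙 (f a ∧ does (a ≟ a)) ≡ 𝟙 (f a)
  at-a = trans (cong (𝟙 ∘ (f a ∧_)) (dec-true (a ≟ a) refl)) (cong 𝟙 (∧-identityʳ (f a)))
  off-a : ∀ i → 𝟙 (f (punchIn a i) ∧ does (punchIn a i ≟ a)) ≡ 0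
  off-a i = cong 𝟙 (trans (cong (f (punchIn a i) ∧_) (dec-false (punchIn a i ≟ a) (punchInᵢ≢i a i)))
                          (∧-zeroʳ _))

∑∑-pick : ∀ {n} (f : Fin n → Fin n → Bool) (a b : Fin n) →
  ∑[ i < n ] ∑[ j < n ] 𝟙 (f i j ∧ (does (i ≟ a) ∧ does (j ≟ b))) ≡ 𝟙 (f a b)
∑∑-pick f a b = begin
  ∑[ i < _ ] ∑[ j < _ ] 𝟙 (f i j ∧ (does (i ≟ a) ∧ does (j ≟ b)))
    ≡⟨ sum-cong-≗ (λ i → sum-cong-≗ (λ j → cong 𝟙 (sym (∧-assoc (f i j) _ _)))) ⟩
  ∑[ i < _ ] ∑[ j < _ ] 𝟙 ((f i j ∧ does (i ≟ a)) ∧ does (j ≟ b))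
    ≡⟨ sum-cong-≗ (λ i → ∑-pick (λ j → f i j ∧ does (i ≟ a)) b) ⟩
  ∑[ i < _ ] 𝟙 (f i b ∧ does (i ≟ a))
    ≡⟨ ∑-pick (λ i → f i b) a ⟩
  𝟙 (f a b) ∎
  where open ≡-Reasoning

sumᴸ-allFin : ∀ {n} (f : Fin n → ℕ) → sumᴸ (map f (allFin n)) ≡ ∑[ i < n ] f i
sumᴸ-allFin f = trans (cong sumᴸ (map-tabulate (λ i → i) f)) (sum-tabulate f)
  where
  sum-tabulate : ∀ {n} (f : Fin n → ℕ) → sumᴸ (List.tabulate f) ≡ ∑[ i < n ] f i
  sum-tabulate {zero} f = refl
  sum-tabulate {suc n} f = cong (f zero +_) (sum-tabulate (f ∘ suc))

∣tabulate∣ : ∀ {n} (f : Fin n → Bool) → ∣ tabulate f ∣ ≡ ∑[ i < n ] 𝟙 (f i)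
∣tabulate∣ {zero} f = refl
∣tabulate∣ {suc n} f with f zero
... | true = cong suc (∣tabulate∣ (f ∘ suc))
... | false = ∣tabulate∣ (f ∘ suc)

removeAt-punchIn : ∀ {a} {A : Set a} {n} (xs : Vec A (suc n)) i j →
  lookup (removeAt xs i) j ≡ lookup xs (punchIn i j)
removeAt-punchIn xs i j = begin
  lookup (removeAt xs i) j
    ≡⟨ insertAt-punchIn (removeAt xs i) i (lookup xs i) j ⟨
  lookup (insertAt (removeAt xs i) i (lookup xs i)) (punchIn i j)
    ≡⟨ cong (λ ys → lookup ys (punchIn i j)) (insertAt-removeAt xs i) ⟩
  lookup xs (punchIn i j) ∎
  where open ≡-Reasoning

module _ {m} {v : Fin (suc m)} where

  ∈-removeAt : ∀ {p : Subset (suc m)} {i} → punchIn v i ∈ p → i ∈ removeAt p v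
  ∈-removeAt {p} {i} ∈p = lookup⇒[]= i _ (trans (removeAt-punchIn p v i) ([]=⇒lookup ∈p))

  ∈-insertAt : ∀ {p : Subset m} {i} → i ∈ p → punchIn v i ∈ insertAt p v true
  ∈-insertAt {p} {i} i∈p = lookup⇒[]= _ _ (trans (insertAt-punchIn p v true i) ([]=⇒lookup i∈p))

  ∈-insertAt-here : ∀ {p : Subset m} → v ∈ insertAt p v true
  ∈-insertAt-here {p} = lookup⇒[]= v _ (insertAt-lookup p v true)

∣insertAt∣ : ∀ {m} (p : Subset m) i x → ∣ insertAt p i x ∣ ≡ ∣ x ∷ p ∣
∣insertAt∣ p           zero    x     = refl
∣insertAt∣ (true ∷ p)  (suc i) true  = cong suc (∣insertAt∣ p i true)
∣insertAt∣ (true ∷ p)  (suc i) false = cong suc (∣insertAt∣ p i false)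
∣insertAt∣ (false ∷ p) (suc i) x     = ∣insertAt∣ p i x

∣p∣≡1+∣removeAt∣ : ∀ {m} {p : Subset (suc m)} {v} → v ∈ p → ∣ p ∣ ≡ suc ∣ removeAt p v ∣
∣p∣≡1+∣removeAt∣ {p = p} {v} v∈p = begin
  ∣ p ∣                                       ≡⟨ cong ∣_∣ (insertAt-removeAt p v) ⟨
  ∣ insertAt (removeAt p v) v (lookup p v) ∣  ≡⟨ ∣insertAt∣ (removeAt p v) v (lookup p v) ⟩
  ∣ lookup p v ∷ removeAt p v ∣               ≡⟨ cong (λ x → ∣ x ∷ removeAt p v ∣) ([]=⇒lookup v∈p) ⟩
  suc ∣ removeAt p v ∣                        ∎
  where open ≡-Reasoning

∣p∪⁅x⁆∣≤1+∣p∣ : ∀ {n} (p : Subset n) x → ∣ p ∪ ⁅ x ⁆ ∣ ≤ suc ∣ p ∣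
∣p∪⁅x⁆∣≤1+∣p∣ (s ∷ p)     zero    rewrite ∨-zeroʳ s | ∪-identityʳ p = s≤s (∣p∣≤∣x∷p∣ s p)
∣p∪⁅x⁆∣≤1+∣p∣ (true ∷ p)  (suc x) = s≤s (∣p∪⁅x⁆∣≤1+∣p∣ p x)
∣p∪⁅x⁆∣≤1+∣p∣ (false ∷ p) (suc x) = ∣p∪⁅x⁆∣≤1+∣p∣ p x

p≢⊤⇒∣p∣<n : ∀ {n} {p : Subset n} → p ≢ ⊤ → ∣ p ∣ < n
p≢⊤⇒∣p∣<n {p = p} p≢⊤ = ≤∧≢⇒< (∣p∣≤n p) (p≢⊤ ∘ ∣p∣≡n⇒p≡⊤)

Adj? : ∀ {n} (G : Graph n) u w → Dec (Adj G u w)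
Adj? G u w = adj G u w ≟ᵇ true

Adj-sym : ∀ {n} (G : Graph n) {u w} → Adj G u w → Adj G w u
Adj-sym G {u} {w} u~w = trans (Graph.sym G w u) u~w

dominating-⊆ : ∀ {n} (H G : Graph n) {D} → IsSpanningSubgraph H G → IsDominating H D → IsDominating G D
dominating-⊆ H G H⊆G dom z with dom z
... | inj₁ z∈D = inj₁ z∈D
... | inj₂ (x , x∈D , x~z) = inj₂ (x , x∈D , H⊆G x z x~z)

dominating-insertAt : ∀ {m} (G : Graph (suc m)) v {D} →
  IsDominating (deleteVertex G v) D → IsDominating G (insertAt D v true)
dominating-insertAt G v dom z with v ≟ z
... | yes refl = inj₁ ∈-insertAt-here
... | no v≢z with dom (punchOut v≢z)
...   | inj₁ z∈D = inj₁ (subst (_∈ _) (punchIn-punchOut v≢z) (∈-insertAt z∈D))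
...   | inj₂ (x , x∈D , x~z) =
        inj₂ (punchIn v x , ∈-insertAt x∈D , subst (Adj G _) (punchIn-punchOut v≢z) x~z)

Isolated : ∀ {n} → Graph n → Fin n → Set
Isolated H v = ∀ u → ¬ Adj H v u

module _ {m} (H : Graph (suc m)) (v : Fin (suc m)) (isolated : Isolated H v)
         {S} (dom : IsDominating H S) where

  isolated∈dominating : v ∈ S
  isolated∈dominating with dom v
  ... | inj₁ v∈S = v∈S
  ... | inj₂ (u , _ , u~v) = ⊥-elim (isolated u (Adj-sym H u~v))

  dominating-removeAt : IsDominating (deleteVertex H v) (removeAt S v)
  dominating-removeAt y with dom (punchIn v y)
  ... | inj₁ y∈S = inj₁ (∈-removeAt y∈S)
  ... | inj₂ (x , x∈S , x~y) with v ≟ x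
  ...   | yes refl = ⊥-elim (isolated _ x~y)
  ...   | no v≢x =
          inj₂ (punchOut v≢x , ∈-removeAt (subst (_∈ S) x≡ x∈S) , subst (λ x → Adj H x _) x≡ x~y)
    where
    x≡ : x ≡ punchIn v (punchOut v≢x)
    x≡ = sym (punchIn-punchOut v≢x)

isolated-γ-bound : ∀ {m} (H : Graph (suc m)) v {k} → Isolated H v →
  (∀ T → IsDominating (deleteVertex H v) T → k ≤ ∣ T ∣) →
  ∀ S → IsDominating H S → suc k ≤ ∣ S ∣
isolated-γ-bound H v isolated bound S dom =
  subst (_ ≤_) (sym (∣p∣≡1+∣removeAt∣ (isolated∈dominating H v isolated dom)))
        (s≤s (bound _ (dominating-removeAt H v isolated dom)))

module _ {n} (K : Graph n) (D : Subset n) where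

  OtherDominator : Fin n → Fin n → Set
  OtherDominator u w = ∃ λ x → x ∈ D × Adj K x w × x ≢ u

  ExternalPrivateNeighbour : Fin n → Fin n → Set
  ExternalPrivateNeighbour u w = u ∈ D × w ∉ D × Adj K u w × ¬ OtherDominator u w

  OtherDominator? : ∀ u w → Dec (OtherDominator u w)
  OtherDominator? u w = any? (λ x → (x ∈? D) ×-dec (Adj? K x w ×-dec ¬? (x ≟ u)))

  ExternalPrivateNeighbour? : ∀ u w → Dec (ExternalPrivateNeighbour u w)
  ExternalPrivateNeighbour? u w =
    (u ∈? D) ×-dec (¬? (w ∈? D) ×-dec (Adj? K u w ×-dec ¬? (OtherDominator? u w)))

private-neighbour-undominated : ∀ {n} (H K : Graph n) {D u w} → IsSpanningSubgraph H K → ¬ Adj H u w →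
  ExternalPrivateNeighbour K D u w → ¬ IsDominating H D
private-neighbour-undominated H K {u = u} {w} H⊆K ¬u~w (_ , w∉D , _ , no-other) dom with dom w
... | inj₁ w∈D = w∉D w∈D
... | inj₂ (x , x∈D , x~w) with x ≟ u
...   | yes refl = ¬u~w x~w
...   | no x≢u = no-other (x , x∈D , H⊆K x w x~w , x≢u)

module _ {n} (K : Graph n) {D : Subset n} (γ-D : IsGammaSet K D)
         (unique : ∀ D' → IsGammaSet K D' → D' ≡ D) where

  unique-γ-set-strict : ∀ S → IsDominating K S → S ≢ D → suc ∣ D ∣ ≤ ∣ S ∣
  unique-γ-set-strict S dom S≢D with ∣ S ∣ ≤? ∣ D ∣
  ... | yes ∣S∣≤∣D∣ = ⊥-elim (S≢D (unique S (dom , λ D' dom' → ≤-trans ∣S∣≤∣D∣ (proj₂ γ-D D' dom'))))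
  ... | no ∣S∣≰∣D∣ = ≰⇒> ∣S∣≰∣D∣

  outsider⇒private-neighbour : ∀ {y} → y ∉ D → ∃₂ (ExternalPrivateNeighbour K D)
  outsider⇒private-neighbour {y} y∉D with proj₁ γ-D y
  ... | inj₁ y∈D = ⊥-elim (y∉D y∈D)
  ... | inj₂ (u , u∈D , u~y) with any? (ExternalPrivateNeighbour? K D u)
  ...   | yes (w , w-private) = u , w , w-private
  ...   | no no-private = ⊥-elim (y∉D (subst (y ∈_) S≡D y∈S))
    where
    S : Subset n
    S = (D - u) ∪ ⁅ y ⁆

    y∈S : y ∈ S
    y∈S = x∈p∪q⁺ (inj₂ (x∈⁅x⁆ y))

    kept : ∀ {x} → x ∈ D → x ≢ u → x ∈ S
    kept x∈D x≢u = x∈p∪q⁺ (inj₁ (x∈p∧x≢y⇒x∈p-y x∈D x≢u))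

    ∣S∣≤∣D∣ : ∣ S ∣ ≤ ∣ D ∣
    ∣S∣≤∣D∣ = ≤-trans (∣p∪⁅x⁆∣≤1+∣p∣ (D - u) y) (x∈p⇒∣p-x∣<∣p∣ u∈D)

    dominated-in-D : ∀ {z} → z ∈ D → z ∈ S ⊎ ∃ λ x → x ∈ S × Adj K x z
    dominated-in-D {z} z∈D with z ≟ u
    ... | yes refl = inj₂ (y , y∈S , Adj-sym K u~y)
    ... | no z≢u = inj₁ (kept z∈D z≢u)

    dominated-outside-D : ∀ {z} → z ∉ D → ∃ λ x → x ∈ S × Adj K x z
    dominated-outside-D {z} z∉D with proj₁ γ-D z
    ... | inj₁ z∈D = ⊥-elim (z∉D z∈D)
    ... | inj₂ (x , x∈D , x~z) with x ≟ u
    ...   | no x≢u = x , kept x∈D x≢u , x~z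
    ...   | yes refl with OtherDominator? K D u z
    ...     | yes (x' , x'∈D , x'~z , x'≢u) = x' , kept x'∈D x'≢u , x'~z
    ...     | no no-other = ⊥-elim (no-private (z , u∈D , z∉D , x~z , no-other))

    S-dominating : IsDominating K S
    S-dominating z with z ∈? D
    ... | yes z∈D = dominated-in-D z∈D
    ... | no z∉D = inj₂ (dominated-outside-D z∉D)

    S≡D : S ≡ D
    S≡D = unique S (S-dominating , λ D' dom' → ≤-trans ∣S∣≤∣D∣ (proj₂ γ-D D' dom'))

two-γ-sets⇒γ<n : ∀ {n} {G : Graph n} → HasTwoGammaSets G → ∃ λ D → IsGammaSet G D × ∣ D ∣ < n
two-γ-sets⇒γ<n (D₁ , D₂ , γ-D₁ , γ-D₂ , D₁≢D₂) with ≡-dec _≟ᵇ_ D₁ ⊤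
... | yes refl = D₂ , γ-D₂ , p≢⊤⇒∣p∣<n (D₁≢D₂ ∘ sym)
... | no D₁≢⊤ = D₁ , γ-D₁ , p≢⊤⇒∣p∣<n D₁≢⊤

removeEdges : ∀ {n} (G : Graph n) (r : Fin n → Fin n → Bool) → (∀ i j → r i j ≡ r j i) → Graph n
removeEdges G r r-sym = record
  { adj    = λ i j → adj G i j ∧ not (r i j)
  ; sym    = λ i j → cong₂ (λ a b → a ∧ not b) (Graph.sym G i j) (r-sym i j)
  ; irrefl = λ i → cong (_∧ not (r i i)) (irrefl G i) }

module _ {n} (G : Graph n) (r : Fin n → Fin n → Bool) (r-sym : ∀ i j → r i j ≡ r j i) where

  removeEdges-⊆ : IsSpanningSubgraph (removeEdges G r r-sym) G
  removeEdges-⊆ _ _ = ∧-true-left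

  removeEdges-removes : ∀ {u w} → r u w ≡ true → ¬ Adj (removeEdges G r r-sym) u w
  removeEdges-removes {u} {w} r≡true u~w =
    case trans (sym u~w) (trans (cong (λ b → adj G u w ∧ not b) r≡true) (∧-zeroʳ (adj G u w))) of λ ()

edge< : ∀ {n} → Graph n → Fin n → Fin n → Bool
edge< G i j = (toℕ i <ᵇ toℕ j) ∧ adj G i j

edgeCount≡∑∑ : ∀ {n} (G : Graph n) → edgeCount G ≡ ∑[ i < n ] ∑[ j < n ] 𝟙 (edge< G i j)
edgeCount≡∑∑ {n} G = trans (sumᴸ-allFin (λ i → sumᴸ (map (λ j → 𝟙 (edge< G i j)) (allFin n))))
                           (sum-cong-≗ (λ i → sumᴸ-allFin (λ j → 𝟙 (edge< G i j))))

removedCount : ∀ {n} → Graph n → (Fin n → Fin n → Bool) → ℕ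
removedCount {n} G r = ∑[ i < n ] ∑[ j < n ] 𝟙 (edge< G i j ∧ r i j)

edgeCount-removeEdges : ∀ {n} (G : Graph n) r r-sym →
  edgeCount G ≡ edgeCount (removeEdges G r r-sym) + removedCount G r
edgeCount-removeEdges {n} G r r-sym = begin
  edgeCount G
    ≡⟨ edgeCount≡∑∑ G ⟩
  ∑[ i < n ] ∑[ j < n ] 𝟙 (edge< G i j)
    ≡⟨ sum-cong-≗ (λ i → sum-cong-≗ (λ j → 𝟙-split (edge< G i j) (r i j))) ⟩
  ∑[ i < n ] ∑[ j < n ] (𝟙 (edge< G i j ∧ not (r i j)) + 𝟙 (edge< G i j ∧ r i j))
    ≡⟨ ∑∑-distrib-+ (λ i j → 𝟙 (edge< G i j ∧ not (r i j))) (λ i j → 𝟙 (edge< G i j ∧ r i j)) ⟩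
  ∑[ i < n ] ∑[ j < n ] 𝟙 (edge< G i j ∧ not (r i j)) + removedCount G r
    ≡⟨ cong (_+ removedCount G r) (sum-cong-≗ (λ i → sum-cong-≗ (λ j →
         cong 𝟙 (∧-assoc (toℕ i <ᵇ toℕ j) (adj G i j) (not (r i j)))))) ⟩
  ∑[ i < n ] ∑[ j < n ] 𝟙 (edge< H i j) + removedCount G r
    ≡⟨ cong (_+ removedCount G r) (edgeCount≡∑∑ H) ⟨
  edgeCount H + removedCount G r ∎
  where
  open ≡-Reasoning
  H = removeEdges G r r-sym

removedCount-∨ : ∀ {n} (G : Graph n) (p q : Fin n → Fin n → Bool) →
  removedCount G (λ i j → p i j ∨ q i j) ≤ removedCount G p + removedCount G q
removedCount-∨ G p q = ≤-trans (∑-mono-≤ (λ i → ∑-mono-≤ (λ j → 𝟙-∨ (edge< G i j) (p i j) (q i j))))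
                                (≤-reflexive (∑∑-distrib-+ (λ i j → 𝟙 (edge< G i j ∧ p i j))
                                                           (λ i j → 𝟙 (edge< G i j ∧ q i j))))

edge<-both-ways : ∀ {n} (G : Graph n) i j → 𝟙 (edge< G i j) + 𝟙 (edge< G j i) ≤ 𝟙 (adj G i j)
edge<-both-ways G i j rewrite Graph.sym G j i =
  𝟙-∧-disjoint (toℕ i <ᵇ toℕ j) (toℕ j <ᵇ toℕ i) (adj G i j) (<ᵇ-asym (toℕ i) (toℕ j))

degree≡∑ : ∀ {n} (G : Graph n) v → degree G v ≡ ∑[ j < n ] 𝟙 (adj G v j)
degree≡∑ G v = ∣tabulate∣ (adj G v)

module _ {n} (v : Fin n) where

  incident : Fin n → Fin n → Bool
  incident i j = does (i ≟ v) ∨ does (j ≟ v)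

  incident-sym : ∀ i j → incident i j ≡ incident j i
  incident-sym i j = ∨-comm (does (i ≟ v)) (does (j ≟ v))

  removedCount-incident : ∀ (G : Graph n) → removedCount G incident ≤ degree G v
  removedCount-incident G = begin
    removedCount G incident
      ≤⟨ removedCount-∨ G (λ i j → does (i ≟ v)) (λ i j → does (j ≟ v)) ⟩
    ∑[ i < n ] ∑[ j < n ] 𝟙 (edge< G i j ∧ does (i ≟ v))
      + ∑[ i < n ] ∑[ j < n ] 𝟙 (edge< G i j ∧ does (j ≟ v))
      ≡⟨ cong₂ _+_ (trans (∑-comm (λ i j → 𝟙 (edge< G i j ∧ does (i ≟ v))))
                          (sum-cong-≗ (λ j → ∑-pick (λ i → edge< G i j) v)))
                   (sum-cong-≗ (λ i → ∑-pick (edge< G i) v)) ⟩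
    ∑[ j < n ] 𝟙 (edge< G v j) + ∑[ j < n ] 𝟙 (edge< G j v)
      ≡⟨ ∑-distrib-+ (λ j → 𝟙 (edge< G v j)) (λ j → 𝟙 (edge< G j v)) ⟨
    ∑[ j < n ] (𝟙 (edge< G v j) + 𝟙 (edge< G j v))
      ≤⟨ ∑-mono-≤ (edge<-both-ways G v) ⟩
    ∑[ j < n ] 𝟙 (adj G v j)
      ≡⟨ degree≡∑ G v ⟨
    degree G v ∎
    where open ≤-Reasoning

module _ {n} (a b : Fin n) where

  joins : Fin n → Fin n → Bool
  joins i j = does (i ≟ a) ∧ does (j ≟ b) ∨ does (i ≟ b) ∧ does (j ≟ a)

  joins-sym : ∀ i j → joins i j ≡ joins j i
  joins-sym i j = trans (∨-comm (does (i ≟ a) ∧ does (j ≟ b)) _)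
                        (cong₂ _∨_ (∧-comm (does (i ≟ b)) _) (∧-comm (does (i ≟ a)) _))

  removedCount-joins : ∀ (G : Graph n) → removedCount G joins ≤ 1
  removedCount-joins G = begin
    removedCount G joins
      ≤⟨ removedCount-∨ G (λ i j → does (i ≟ a) ∧ does (j ≟ b)) (λ i j → does (i ≟ b) ∧ does (j ≟ a)) ⟩
    _ ≡⟨ cong₂ _+_ (∑∑-pick (edge< G) a b) (∑∑-pick (edge< G) b a) ⟩
    𝟙 (edge< G a b) + 𝟙 (edge< G b a)
      ≤⟨ edge<-both-ways G a b ⟩
    𝟙 (adj G a b)
      ≤⟨ 𝟙≤1 (adj G a b) ⟩
    1 ∎
    where open ≤-Reasoning

isolate : ∀ {n} → Graph n → Fin n → Graph n
isolate G v = removeEdges G (incident v) (incident-sym v)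

deleteEdge : ∀ {n} → Graph n → Fin n → Fin n → Graph n
deleteEdge G a b = removeEdges G (joins a b) (joins-sym a b)

isolate-isolates : ∀ {n} (G : Graph n) v → Isolated (isolate G v) v
isolate-isolates G v u =
  removeEdges-removes G (incident v) (incident-sym v) (cong (_∨ does (u ≟ v)) (dec-true (v ≟ v) refl))

deleteEdge-deletes : ∀ {n} (G : Graph n) a b → ¬ Adj (deleteEdge G a b) a b
deleteEdge-deletes G a b =
  removeEdges-removes G (joins a b) (joins-sym a b)
    (cong₂ (λ x y → x ∧ y ∨ does (a ≟ b) ∧ does (b ≟ a)) (dec-true (a ≟ a) refl) (dec-true (b ≟ b) refl))

edgeCount-isolate : ∀ {n} (G : Graph n) v → edgeCount G ≤ edgeCount (isolate G v) + degree G v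
edgeCount-isolate G v = ≤-trans (≤-reflexive (edgeCount-removeEdges G (incident v) (incident-sym v)))
                                (+-monoʳ-≤ _ (removedCount-incident v G))

edgeCount-deleteEdge : ∀ {n} (G : Graph n) a b → edgeCount G ≤ edgeCount (deleteEdge G a b) + 1
edgeCount-deleteEdge G a b = ≤-trans (≤-reflexive (edgeCount-removeEdges G (joins a b) (joins-sym a b)))
                                     (+-monoʳ-≤ _ (removedCount-joins a b G))

isolate-⊆ : ∀ {n} (G : Graph n) v → IsSpanningSubgraph (isolate G v) G
isolate-⊆ G v = removeEdges-⊆ G (incident v) (incident-sym v)

deleteEdge-⊆ : ∀ {n} (G : Graph n) a b → IsSpanningSubgraph (deleteEdge G a b) G
deleteEdge-⊆ G a b = removeEdges-⊆ G (joins a b) (joins-sym a b)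

bondage-witness : ∀ {n} (G H : Graph n) {k} D → IsSpanningSubgraph H G → edgeCount G ≤ edgeCount H + k →
  IsDominating G D → (∀ S → IsDominating H S → ∣ D ∣ < ∣ S ∣) → BondageAtMost G k
bondage-witness G H _ H⊆G count dom bigger =
  H , H⊆G , m≤n+o⇒m∸n≤o (edgeCount G) (edgeCount H) count ,
  λ { _ _ (_ , γ-D₀ , refl) (S , γ-S , refl) → ≤-<-trans (proj₂ γ-D₀ _ dom) (bigger S (proj₁ γ-S)) }

module _ {m} (G : Graph (suc m)) (v : Fin (suc m)) {D} (γ-D : IsGammaSet (deleteVertex G v) D) where

  bondage-if-γ-set-full : (∀ y → y ∈ D) → HasTwoGammaSets G → BondageAtMost G (degree G v + 1)
  bondage-if-γ-set-full full two with two-γ-sets⇒γ<n {G = G} two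
  ... | D₀ , γ-D₀ , ∣D₀∣<n = bondage-witness G H D₀ (isolate-⊆ G v) count (proj₁ γ-D₀) bigger
    where
    H = isolate G v

    H-v⊆G-v : IsSpanningSubgraph (deleteVertex H v) (deleteVertex G v)
    H-v⊆G-v i j = isolate-⊆ G v (punchIn v i) (punchIn v j)

    count : edgeCount G ≤ edgeCount H + (degree G v + 1)
    count = ≤-trans (edgeCount-isolate G v) (+-monoʳ-≤ (edgeCount H) (m≤m+n (degree G v) 1))

    γ≥m : ∀ T → IsDominating (deleteVertex H v) T → m ≤ ∣ T ∣
    γ≥m T dom = begin
      m          ≡⟨ ∣⊤∣≡n m ⟨
      ∣ ⊤ {m} ∣  ≤⟨ p⊆q⇒∣p∣≤∣q∣ {p = ⊤} (λ {y} _ → full y) ⟩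
      ∣ D ∣      ≤⟨ proj₂ γ-D T (dominating-⊆ (deleteVertex H v) (deleteVertex G v) H-v⊆G-v dom) ⟩
      ∣ T ∣      ∎
      where open ≤-Reasoning

    bigger : ∀ S → IsDominating H S → ∣ D₀ ∣ < ∣ S ∣
    bigger S dom = ≤-trans ∣D₀∣<n (isolated-γ-bound H v (isolate-isolates G v) γ≥m S dom)

  bondage-if-private-neighbour : (∀ D' → IsGammaSet (deleteVertex G v) D' → D' ≡ D) → ∀ {u w} →
    ExternalPrivateNeighbour (deleteVertex G v) D u w → BondageAtMost G (degree G v + 1)
  bondage-if-private-neighbour unique {u} {w} private-w =
    bondage-witness G H (insertAt D v true) H⊆G count (dominating-insertAt G v (proj₁ γ-D)) bigger
    where
    I = isolate G v
    H = deleteEdge I (punchIn v u) (punchIn v w)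

    H⊆I : IsSpanningSubgraph H I
    H⊆I = deleteEdge-⊆ I (punchIn v u) (punchIn v w)

    H⊆G : IsSpanningSubgraph H G
    H⊆G i j = isolate-⊆ G v i j ∘ H⊆I i j

    H-v⊆G-v : IsSpanningSubgraph (deleteVertex H v) (deleteVertex G v)
    H-v⊆G-v i j = H⊆G (punchIn v i) (punchIn v j)

    D-misses-H-v : ¬ IsDominating (deleteVertex H v) D
    D-misses-H-v = private-neighbour-undominated (deleteVertex H v) (deleteVertex G v) H-v⊆G-v
                     (deleteEdge-deletes I (punchIn v u) (punchIn v w)) private-w

    count : edgeCount G ≤ edgeCount H + (degree G v + 1)
    count = begin
      edgeCount G                     ≤⟨ edgeCount-isolate G v ⟩
      edgeCount I + degree G v        ≤⟨ +-monoˡ-≤ _ (edgeCount-deleteEdge I (punchIn v u) (punchIn v w)) ⟩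
      edgeCount H + 1 + degree G v    ≡⟨ +-assoc (edgeCount H) 1 _ ⟩
      edgeCount H + (1 + degree G v)  ≡⟨ cong (edgeCount H +_) (+-comm 1 _) ⟩
      edgeCount H + (degree G v + 1)  ∎
      where open ≤-Reasoning

    γ>∣D∣ : ∀ T → IsDominating (deleteVertex H v) T → suc ∣ D ∣ ≤ ∣ T ∣
    γ>∣D∣ T dom = unique-γ-set-strict (deleteVertex G v) γ-D unique T
                    (dominating-⊆ (deleteVertex H v) (deleteVertex G v) H-v⊆G-v dom)
                    (λ { refl → D-misses-H-v dom })

    bigger : ∀ S → IsDominating H S → ∣ insertAt D v true ∣ < ∣ S ∣
    bigger S dom = subst (_< ∣ S ∣) (sym (∣insertAt∣ D v true))
      (isolated-γ-bound H v (λ x → isolate-isolates G v x ∘ H⊆I v x) γ>∣D∣ S dom)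

theorem3p7 : ∀ {m} (G : Graph (suc m)) (δ : ℕ) →
    IsHypoUniqueDomination G → IsMinDegree G δ → BondageAtMost G (δ + 1)
theorem3p7 G _ (two-γ-sets , hypo-unique) ((v , refl) , _) with hypo-unique v
... | D , γ-D , unique-D with all? (_∈? D)
...   | yes full = bondage-if-γ-set-full G v γ-D full two-γ-sets
...   | no ¬full with ¬∀⟶∃¬ _ (_∈ D) (_∈? D) ¬full
...     | _ , y∉D with outsider⇒private-neighbour (deleteVertex G v) γ-D unique-D y∉D
...       | _ , _ , private-w = bondage-if-private-neighbour G v γ-D unique-D private-w
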